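{- Let $W,n$ be positive integers and let $H_{W,n}$ be the hypergraph of $n$-term arithmetic progressions in $[W]$, with maximum vertex degree $d$. Then for every $k\ge 3$, any fixed vertex of $H_{W,n}$ is contained in at most $k^2\,d\,(nd)^{k-2}\,n^4$ almost disjoint cycles $(s_1,\ldots,s_k)$ of length $k$ with $|s_1\cap s_k|=1$.
   Context: $H_{W,n}=(V,E)$ has vertex set $V=[W]=\{1,\ldots,W\}$, and its edges are the sets $\{a,a+\gamma,\ldots,a+(n-1)\gamma\}\subseteq[W]$ with $\gamma$ a positive integer (arithmetic progressions of length $n$). The degree of a vertex is the number of edges containing it. A chain is a sequence of edges $(s_1,\ldots,s_k)$ with $|s_i\cap s_{i+1}|=1$ for $i\in[k-1]$ and the sets $s_i\cap s_{i+1}$ pairwise disjoint; it is disjoint if $s_i\cap s_j=\emptyset$ whenever $|i-j|>1$. A chain $(s_1,\ldots,s_k)$ is an almost disjoint cycle if $s_1\cap s_k\ne\emptyset$ and both $(s_1,\ldots,s_{k-1})$ and $(s_2,\ldots,s_k)$ are disjoint chains. A vertex is contained in a chain if it lies in one of its edges; cycles are counted as sequences. -}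

module Defs where

open import Data.Nat using (ℕ; zero; suc; _+_; _*_; _∸_; _≤_; _⊔_)
open import Data.Nat.Properties using (_≟_; _≤?_)
open import Data.Bool using (Bool)
import Data.Bool as Bool
open import Data.Fin using (Fin; toℕ)
open import Data.Fin.Properties using (any?)
open import Data.Fin.Subset using (Subset; _∈_; _∩_; ∣_∣; Empty)
open import Data.Fin.Subset.Properties using (_∈?_)
open import Data.Vec using (Vec; lookup; tabulate; head; last; init; tail)
open import Data.Vec.Properties using (≡-dec)
open import Data.List using (List; length; filter; deduplicate; concatMap; map; foldr; upTo; allFin; _∷_; [])
open import Data.Product using (Σ; ∃; _×_; _,_)
open import Relation.Binary.PropositionalEquality using (_≡_; _≢_)
open import Relation.Nullary using (¬_; does)

-- Vertices of H_{W,n}: the vertex x : Fin W stands for the integer toℕ x + 1 ∈ [W].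

apSet : (W n a γ : ℕ) → Subset W
apSet W n a γ = tabulate (λ x → does (any? (λ (j : Fin n) → suc (toℕ x) ≟ a + toℕ j * γ)))

IsEdge : (W n : ℕ) → Subset W → Set
IsEdge W n s = Σ ℕ λ a → Σ ℕ λ γ →
  (1 ≤ a) × (1 ≤ γ) × (a + (n ∸ 1) * γ ≤ W) × (s ≡ apSet W n a γ)

-- Explicit finite list of the edges (each edge once); every edge arises with
-- 1 ≤ a ≤ W and 1 ≤ γ ≤ W.
edgeParams : (W n : ℕ) → List (ℕ × ℕ)
edgeParams W n =
  filter (λ p → Data.Product.proj₁ p + (n ∸ 1) * Data.Product.proj₂ p ≤? W)
    (concatMap (λ a → map (λ γ → (suc a , suc γ)) (upTo W)) (upTo W))

edges : (W n : ℕ) → List (Subset W)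
edges W n = deduplicate (≡-dec Bool._≟_)
  (map (λ p → apSet W n (Data.Product.proj₁ p) (Data.Product.proj₂ p)) (edgeParams W n))

degree : (W n : ℕ) → Fin W → ℕ
degree W n x = length (filter (λ s → x ∈? s) (edges W n))

maxDegree : (W n : ℕ) → ℕ
maxDegree W n = foldr _⊔_ 0 (map (degree W n) (allFin W))

module _ {W : ℕ} where

  IsChain : ∀ {k} → Vec (Subset W) k → Set
  IsChain {k} s =
    (∀ (i j : Fin k) → toℕ j ≡ suc (toℕ i) → ∣ lookup s i ∩ lookup s j ∣ ≡ 1)
    × (∀ (i j i' j' : Fin k) → toℕ j ≡ suc (toℕ i) → toℕ j' ≡ suc (toℕ i') → i ≢ i' →
         Empty ((lookup s i ∩ lookup s j) ∩ (lookup s i' ∩ lookup s j')))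

  IsDisjointChain : ∀ {k} → Vec (Subset W) k → Set
  IsDisjointChain {k} s = IsChain s
    × (∀ (i j : Fin k) → suc (toℕ i) Data.Nat.< toℕ j → Empty (lookup s i ∩ lookup s j))

  IsAlmostDisjointCycle : ∀ {k} → Vec (Subset W) k → Set
  IsAlmostDisjointCycle {zero} s = Data.Empty.⊥
    where import Data.Empty
  IsAlmostDisjointCycle {suc m} s = IsChain s
    × ¬ Empty (head s ∩ last s)
    × IsDisjointChain (init s)
    × IsDisjointChain (tail s)

  ContainedIn : ∀ {k} → Fin W → Vec (Subset W) k → Set
  ContainedIn {k} x s = ∃ λ (i : Fin k) → x ∈ lookup s i

CountedCycle : (W n : ℕ) → Fin W → ∀ {k} → Vec (Subset W) k → Set
CountedCycle W n x {k} s =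
  (∀ (i : Fin k) → IsEdge W n (lookup s i))
  × IsAlmostDisjointCycle s
  × (∣ head′ s ∩ last′ s ∣ ≡ 1)
  × ContainedIn x s
  where
    head′ : ∀ {k} → Vec (Subset W) k → Subset W
    head′ {zero} _ = Data.Fin.Subset.⊥
    head′ {suc _} v = head v
    last′ : ∀ {k} → Vec (Subset W) k → Subset W
    last′ {zero} _ = Data.Fin.Subset.⊥
    last′ {suc _} v = last v

-- Walk once around the cycle, starting from an edge s_i that contains x.  There are k choices
-- for i and at most d for s_i among the edges through x.  Each further edge but the last is the
-- e-th edge (e < d) through the p-th vertex (p < n) of its predecessor.  The last edge meets its
-- predecessor and s_i in two vertices, which are distinct because an almost disjoint cycle has
-- no vertex in three consecutive edges; two distinct terms at known positions determine an
-- arithmetic progression, so n⁴ choices pin it down.  This injects the cycles into a set of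
-- k · d · (nd)^(k-2) · n⁴ codes.

module Submission where

open import Defs
open import Data.Nat using (ℕ; zero; suc; _+_; _*_; _^_; _∸_; _≤_; _<_; z≤n; s≤s; _⊔_; _%_; NonZero)
open import Data.Nat.DivMod using (_mod_; m<n⇒m%n≡m; [m+n]%n≡m%n; %-distribˡ-+; m%n%n≡m%n; m%n<n)
open import Data.Nat.Properties
open import Data.Fin using (Fin; toℕ; fromℕ; inject₁)
import Data.Fin as Fin
open import Data.Fin.Properties using (injective⇒≤; any?; toℕ<n; toℕ-injective; toℕ-fromℕ<; toℕ-fromℕ; toℕ-inject₁)
open import Data.Fin.Subset using (Subset; _∈_; _∩_; ∣_∣; Nonempty)
open import Data.Fin.Subset.Properties using (_∈?_; x∈p∩q⁻; x∈p∩q⁺; nonempty?; Empty-unique; ∣⊥∣≡0)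
open import Data.Bool using (true; T)
import Data.Bool as Bool
open import Data.Unit using (tt)
open import Data.Vec using (Vec; []; _∷_; lookup; head; last; init; tail)
open import Data.Vec.Relation.Binary.Pointwise.Extensional using (ext; Pointwise-≡⇒≡)
open import Data.Vec.Properties using (≡-dec; lookup∘tabulate; []=⇒lookup)
open import Data.List using (List; []; _∷_; length; upTo; filter; allFin; cartesianProductWith)
open import Data.Nat.ListAction using (product)
import Data.List as List
open import Data.List.Properties using (length-++; length-map; length-upTo)
open import Data.List.Membership.Propositional using () renaming (_∈_ to _∈ₗ_)
open import Data.List.Membership.Propositional.Properties
  using (∈-lookup; ∈-upTo⁺; ∈-cartesianProductWith⁺; ∈-filter⁺; ∈-filter⁻; ∈-allFin; ∈-map⁺; ∈-concatMap⁺;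
         ∈-deduplicate⁺)
open import Data.List.Relation.Unary.All using (All)
import Data.List.Relation.Unary.All as All
open import Data.List.Relation.Unary.Any using (here; there; index)
import Data.List.Relation.Unary.Any as Any
open import Data.List.Relation.Unary.Any.Properties using (lookup-index)
open import Data.List.Relation.Unary.Unique.Propositional using (Unique; _∷_)
open import Data.List.Relation.Unary.Unique.Propositional.Properties using (allFin⁺; filter⁺)
open import Data.List.Relation.Binary.Pointwise using (Pointwise; []; _∷_)
open import Data.Maybe using (Maybe; just; nothing)
open import Data.Maybe.Properties using (just-injective)
open import Data.Sum using (inj₁; inj₂)
open import Data.Product using (Σ; ∃-syntax; _×_; _,_; proj₁; proj₂; uncurry)
open import Data.Empty using (⊥; ⊥-elim)
open import Function using (_∘_)
open import Function.Definitions using (Injective)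
open import Relation.Binary.PropositionalEquality
open import Relation.Binary using (tri<; tri≈; tri>)
open import Relation.Nullary using (Dec; does; yes; no; contradiction)
open import Relation.Nullary.Decidable using (toWitness; isYes≗does)

Unique⇒lookup-injective : {A : Set} {xs : List A} → Unique xs → Injective _≡_ _≡_ (List.lookup xs)
Unique⇒lookup-injective (_  ∷ _) {Fin.zero}  {Fin.zero}  _  = refl
Unique⇒lookup-injective (x∉ ∷ _) {Fin.zero}  {Fin.suc j} eq = ⊥-elim (All.lookup x∉ (∈-lookup j) eq)
Unique⇒lookup-injective (x∉ ∷ _) {Fin.suc i} {Fin.zero}  eq = ⊥-elim (All.lookup x∉ (∈-lookup i) (sym eq))
Unique⇒lookup-injective (_  ∷ u) {Fin.suc i} {Fin.suc j} eq = cong Fin.suc (Unique⇒lookup-injective u eq)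

length-≤-by-coding : {A B : Set} (Code : A → B → Set) {xs : List A} (L : List B) → Unique xs →
  (∀ {a} → a ∈ₗ xs → ∃[ b ] b ∈ₗ L × Code a b) →
  (∀ {a a′} b → Code a b → Code a′ b → a ≡ a′) →
  length xs ≤ length L
length-≤-by-coding Code {xs} L unique code decode = injective⇒≤ {f = index ∘ code∈ₗL} injective
  where
  codeAt : (i : Fin (length xs)) → ∃[ b ] b ∈ₗ L × Code (List.lookup xs i) b
  codeAt i = code (∈-lookup i)

  code∈ₗL : (i : Fin (length xs)) → proj₁ (codeAt i) ∈ₗ L
  code∈ₗL i = proj₁ (proj₂ (codeAt i))

  injective : Injective _≡_ _≡_ (index ∘ code∈ₗL)
  injective {i} {j} eq = Unique⇒lookup-injective unique
    (decode _ (proj₂ (proj₂ (codeAt i))) (subst (Code _) (sym sameCode) (proj₂ (proj₂ (codeAt j)))))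
    where
    sameCode : proj₁ (codeAt i) ≡ proj₁ (codeAt j)
    sameCode = trans (lookup-index (code∈ₗL i))
      (trans (cong (List.lookup L) eq) (sym (lookup-index (code∈ₗL j))))

box : List ℕ → List (List ℕ)
box []       = [] ∷ []
box (b ∷ bs) = cartesianProductWith _∷_ (upTo b) (box bs)

length-cartesianProductWith : {A B C : Set} (f : A → B → C) (xs : List A) (ys : List B) →
  length (cartesianProductWith f xs ys) ≡ length xs * length ys
length-cartesianProductWith f []       ys = refl
length-cartesianProductWith f (x ∷ xs) ys = begin
  length (List.map (f x) ys List.++ cartesianProductWith f xs ys) ≡⟨ length-++ (List.map (f x) ys) ⟩
  length (List.map (f x) ys) + length (cartesianProductWith f xs ys)
    ≡⟨ cong₂ _+_ (length-map (f x) ys) (length-cartesianProductWith f xs ys) ⟩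
  length ys + length xs * length ys ∎
  where open ≡-Reasoning

length-box : ∀ bs → length (box bs) ≡ product bs
length-box []       = refl
length-box (b ∷ bs) = begin
  length (box (b ∷ bs))             ≡⟨ length-cartesianProductWith _∷_ (upTo b) (box bs) ⟩
  length (upTo b) * length (box bs) ≡⟨ cong₂ _*_ (length-upTo b) (length-box bs) ⟩
  b * product bs                    ∎
  where open ≡-Reasoning

∈-box : ∀ {cs bs} → Pointwise _<_ cs bs → cs ∈ₗ box bs
∈-box []            = here refl
∈-box (c<b ∷ cs<bs) = ∈-cartesianProductWith⁺ _∷_ (∈-upTo⁺ c<b) (∈-box cs<bs)

_‼_ : {A : Set} → List A → ℕ → Maybe A
[]       ‼ _     = nothing
(x ∷ xs) ‼ zero  = just x
(x ∷ xs) ‼ suc c = xs ‼ c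

‼-index : {A : Set} {x : A} {xs : List A} → x ∈ₗ xs → ∃[ c ] c < length xs × xs ‼ c ≡ just x
‼-index (here refl) = 0 , s≤s z≤n , refl
‼-index (there x∈xs) with c , c<len , eq ← ‼-index x∈xs = suc c , s≤s c<len , eq

‼-functional : {A : Set} (xs : List A) {c : ℕ} {x y : A} → xs ‼ c ≡ just x → xs ‼ c ≡ just y → x ≡ y
‼-functional xs x≡ y≡ = just-injective (trans (sym x≡) y≡)

IsTerm : {W : ℕ} → ℕ → ℕ → ℕ → Fin W → Set
IsTerm a γ q y = suc (toℕ y) ≡ a + q * γ

∈-apSet⁻ : ∀ {W n a γ} {y : Fin W} → y ∈ apSet W n a γ → Σ (Fin n) λ j → IsTerm a γ (toℕ j) y
∈-apSet⁻ {W} {n} {a} {γ} {y} y∈ =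
  toWitness {a? = any? isTerm?} (subst T (sym (trans (isYes≗does _) inApSet)) tt)
  where
  isTerm? : (j : Fin n) → Dec (IsTerm a γ (toℕ j) y)
  isTerm? j = suc (toℕ y) ≟ a + toℕ j * γ

  inApSet : does (any? isTerm?) ≡ true
  inApSet = trans (sym (lookup∘tabulate _ y)) ([]=⇒lookup y∈)

apParams-unique-< : ∀ {a γ a′ γ′ p q} → p < q →
  a + p * γ ≡ a′ + p * γ′ → a + q * γ ≡ a′ + q * γ′ → a ≡ a′ × γ ≡ γ′
apParams-unique-< {a} {γ} {a′} {γ′} {p} p<q e₁ e₂ with o , refl ← m≤n⇒∃[o]m+o≡n p<q = a≡a′ , γ≡γ′
  where
  split : ∀ b g → b + (suc p + o) * g ≡ (b + p * g) + suc o * g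
  split b g = begin
    b + (suc p + o) * g     ≡⟨ cong (λ r → b + r * g) (sym (+-suc p o)) ⟩
    b + (p + suc o) * g     ≡⟨ cong (b +_) (*-distribʳ-+ g p (suc o)) ⟩
    b + (p * g + suc o * g) ≡⟨ sym (+-assoc b (p * g) (suc o * g)) ⟩
    b + p * g + suc o * g   ∎
    where open ≡-Reasoning

  γ≡γ′ : γ ≡ γ′
  γ≡γ′ = *-cancelˡ-≡ γ γ′ (suc o) (+-cancelˡ-≡ (a + p * γ) _ _ (begin
    a + p * γ + suc o * γ   ≡⟨ sym (split a γ) ⟩
    a + (suc p + o) * γ     ≡⟨ e₂ ⟩
    a′ + (suc p + o) * γ′   ≡⟨ split a′ γ′ ⟩
    a′ + p * γ′ + suc o * γ′ ≡⟨ cong (_+ suc o * γ′) (sym e₁) ⟩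
    a + p * γ + suc o * γ′  ∎))
    where open ≡-Reasoning

  a≡a′ : a ≡ a′
  a≡a′ = +-cancelʳ-≡ (p * γ) a a′ (trans e₁ (cong (λ g → a′ + p * g) (sym γ≡γ′)))

apParams-unique : ∀ {W a γ a′ γ′ p q} {y z : Fin W} → y ≢ z →
  IsTerm a γ p y → IsTerm a γ q z → IsTerm a′ γ′ p y → IsTerm a′ γ′ q z → a ≡ a′ × γ ≡ γ′
apParams-unique {p = p} {q} y≢z y-term z-term y-term′ z-term′ with <-cmp p q
... | tri< p<q _ _ = apParams-unique-< p<q (trans (sym y-term) y-term′) (trans (sym z-term) z-term′)
... | tri≈ _ refl _ = ⊥-elim (y≢z (toℕ-injective (suc-injective (trans y-term (sym z-term)))))
... | tri> _ _ q<p = apParams-unique-< q<p (trans (sym z-term) z-term′) (trans (sym y-term) y-term′)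

vertices : {W : ℕ} → Subset W → List (Fin W)
vertices {W} s = filter (_∈? s) (allFin W)

∈-vertices⁻ : ∀ {W} {s : Subset W} {y} → y ∈ₗ vertices s → y ∈ s
∈-vertices⁻ {W} {s} y∈ = proj₂ (∈-filter⁻ (_∈? s) {xs = allFin W} y∈)

length-vertices-apSet : ∀ {W n a γ} → length (vertices (apSet W n a γ)) ≤ n
length-vertices-apSet {W} {n} {a} {γ} = subst (length (vertices (apSet W n a γ)) ≤_) (length-upTo n)
  (length-≤-by-coding (λ y q → IsTerm a γ q y) (upTo n) unique position decode)
  where
  unique : Unique (vertices (apSet W n a γ))
  unique = filter⁺ (_∈? apSet W n a γ) (allFin⁺ W)

  position : ∀ {y} → y ∈ₗ vertices (apSet W n a γ) → ∃[ q ] q ∈ₗ upTo n × IsTerm a γ q y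
  position y∈ with j , term ← ∈-apSet⁻ (∈-vertices⁻ y∈) = toℕ j , ∈-upTo⁺ (toℕ<n j) , term

  decode : ∀ {y y′ : Fin W} q → IsTerm a γ q y → IsTerm a γ q y′ → y ≡ y′
  decode _ term term′ = toℕ-injective (suc-injective (trans term (sym term′)))

vertex-index : ∀ {W n} {s : Subset W} {y} → IsEdge W n s → y ∈ s → ∃[ p ] p < n × vertices s ‼ p ≡ just y
vertex-index {W} {n} {s} {y} (a , γ , _ , _ , _ , refl) y∈
  with p , p<len , eq ← ‼-index (∈-filter⁺ (_∈? s) (∈-allFin y) y∈) =
  p , ≤-trans p<len (length-vertices-apSet {W} {n} {a} {γ}) , eq

-- edgeParams only lists steps γ ≤ W: the bound on the last term forces this when n ≥ 2, and
-- when n ≤ 1 the step is irrelevant.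
boundedStep : ∀ {W} a n γ → 1 ≤ γ → suc a + (n ∸ 1) * γ ≤ W →
  ∃[ γ′ ] suc γ′ ≤ W × suc a + (n ∸ 1) * suc γ′ ≤ W × apSet W n (suc a) γ ≡ apSet W n (suc a) (suc γ′)
boundedStep a zero          γ       _ bound = 0 , ≤-trans (s≤s z≤n) bound , bound , refl
boundedStep a (suc zero)    γ       _ bound = 0 , ≤-trans (s≤s z≤n) bound , bound , refl
boundedStep a (suc (suc k)) (suc γ) _ bound =
  γ , ≤-trans (≤-trans (m≤m+n (suc γ) (k * suc γ)) (m≤n+m _ (suc a))) bound , bound , refl

∈-edges : ∀ {W n} {s : Subset W} → IsEdge W n s → s ∈ₗ edges W n
∈-edges {W} {n} (suc a , γ , _ , 1≤γ , bound , refl)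
  with γ′ , γ′<W , bound′ , sameSet ← boundedStep a n γ 1≤γ bound =
  subst (_∈ₗ edges W n) (sym sameSet)
    (∈-deduplicate⁺ (≡-dec Bool._≟_) (∈-map⁺ (uncurry (apSet W n)) params∈))
  where
  withStart : ℕ → ℕ → ℕ × ℕ
  withStart a γ = suc a , suc γ

  params∈ : (suc a , suc γ′) ∈ₗ edgeParams W n
  params∈ = ∈-filter⁺ (λ p → proj₁ p + (n ∸ 1) * proj₂ p ≤? W)
    (∈-concatMap⁺ (λ a → List.map (withStart a) (upTo W))
      (Any.map (λ { refl → ∈-map⁺ (withStart a) (∈-upTo⁺ γ′<W) })
        (∈-upTo⁺ (≤-trans (m≤m+n (suc a) _) bound))))
    bound′

edgesThrough : (W n : ℕ) → Fin W → List (Subset W)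
edgesThrough W n y = filter (y ∈?_) (edges W n)

≤-foldr-⊔ : {A : Set} (f : A → ℕ) {x : A} {xs : List A} → x ∈ₗ xs → f x ≤ List.foldr _⊔_ 0 (List.map f xs)
≤-foldr-⊔ f {xs = y ∷ ys} (here refl)  = m≤m⊔n (f y) _
≤-foldr-⊔ f {xs = y ∷ ys} (there x∈ys) = ≤-trans (≤-foldr-⊔ f x∈ys) (m≤n⊔m (f y) _)

edge-index : ∀ {W n} {s : Subset W} {y} → IsEdge W n s → y ∈ s →
  ∃[ e ] e < maxDegree W n × edgesThrough W n y ‼ e ≡ just s
edge-index {W} {n} {y = y} edge y∈
  with e , e<deg , eq ← ‼-index (∈-filter⁺ (y ∈?_) (∈-edges {n = n} edge) y∈) =
  e , ≤-trans e<deg (≤-foldr-⊔ (degree W n) (∈-allFin y)) , eq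

module Walks (W n : ℕ) where

  d : ℕ
  d = maxDegree W n

  -- A code for the edges g (1 + t), …, g (1 + t + j), read off from g 0 and g t.  Every edge but
  -- the last is the e-th edge through the p-th vertex of its predecessor; the last one is the
  -- progression through two distinct vertices at the recorded positions, one shared with its
  -- predecessor and one with g 0.
  Pins : (ℕ → Subset W) → ℕ → List ℕ → Set
  Pins g t (py ∷ pz ∷ qy ∷ qz ∷ []) =
    Σ (Fin W) λ y → Σ (Fin W) λ z →
    vertices (g t) ‼ py ≡ just y × vertices (g 0) ‼ pz ≡ just z × y ≢ z ×
    Σ ℕ λ a → Σ ℕ λ γ → g (suc t) ≡ apSet W n a γ × IsTerm a γ qy y × IsTerm a γ qz z
  Pins g t _ = ⊥

  Walk : (ℕ → Subset W) → ℕ → ℕ → List ℕ → Set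
  Walk g t zero    c           = Pins g t c
  Walk g t (suc j) (p ∷ e ∷ c) =
    Σ (Fin W) λ y → vertices (g t) ‼ p ≡ just y × edgesThrough W n y ‼ e ≡ just (g (suc t)) ×
    Walk g (suc t) j c
  Walk g t (suc j) _           = ⊥

  walkBounds : ℕ → List ℕ
  walkBounds zero    = n ∷ n ∷ n ∷ n ∷ []
  walkBounds (suc j) = n ∷ d ∷ walkBounds j

  product-walkBounds : ∀ j → product (walkBounds j) ≡ (n * d) ^ j * n ^ 4
  product-walkBounds zero    = sym (*-identityˡ (n ^ 4))
  product-walkBounds (suc j) = begin
    n * (d * product (walkBounds j)) ≡⟨ cong (λ r → n * (d * r)) (product-walkBounds j) ⟩
    n * (d * ((n * d) ^ j * n ^ 4))  ≡⟨ sym (*-assoc n d _) ⟩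
    n * d * ((n * d) ^ j * n ^ 4)    ≡⟨ sym (*-assoc (n * d) _ (n ^ 4)) ⟩
    (n * d) ^ suc j * n ^ 4          ∎
    where open ≡-Reasoning

  pins-determined : ∀ {g g′ t} c → Pins g t c → Pins g′ t c → g t ≡ g′ t → g 0 ≡ g′ 0 →
    g (suc t) ≡ g′ (suc t)
  pins-determined {g} {g′} {t} (py ∷ pz ∷ qy ∷ qz ∷ [])
    (y , z , y≡ , z≡ , y≢z , a , γ , g≡ , y-term , z-term)
    (y′ , z′ , y′≡ , z′≡ , _ , a′ , γ′ , g′≡ , y′-term , z′-term) gt≡ g0≡
    with refl ← ‼-functional (vertices (g t)) y≡ (subst (λ h → vertices h ‼ py ≡ just y′) (sym gt≡) y′≡)
       | refl ← ‼-functional (vertices (g 0)) z≡ (subst (λ h → vertices h ‼ pz ≡ just z′) (sym g0≡) z′≡)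
    with refl , refl ← apParams-unique {a = a} {γ} {a′} {γ′} {qy} {qz} y≢z y-term z-term y′-term z′-term
    = trans g≡ (sym g′≡)

  walk-determined : ∀ {g g′ t} j c → Walk g t j c → Walk g′ t j c → g t ≡ g′ t → g 0 ≡ g′ 0 →
    ∀ u → u ≤ suc j → g (u + t) ≡ g′ (u + t)
  walk-determined j c w w′ gt≡ g0≡ zero _ = gt≡
  walk-determined zero c w w′ gt≡ g0≡ (suc zero) _ = pins-determined c w w′ gt≡ g0≡
  walk-determined zero c w w′ gt≡ g0≡ (suc (suc u)) (s≤s ())
  walk-determined {g} {g′} {t} (suc j) (p ∷ e ∷ c) (y , y≡ , e≡ , w) (y′ , y′≡ , e′≡ , w′) gt≡ g0≡
    (suc u) (s≤s u≤j)
    with refl ← ‼-functional (vertices (g t)) y≡ (subst (λ h → vertices h ‼ p ≡ just y′) (sym gt≡) y′≡)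
    = subst (λ r → g r ≡ g′ r) (+-suc u t)
        (walk-determined j c w w′ (‼-functional (edgesThrough W n y) e≡ e′≡) g0≡ u u≤j)

  module _ (g : ℕ → Subset W) (edge : ∀ u → IsEdge W n (g u))
           (meet : ∀ u → Nonempty (g u ∩ g (suc u)))
           (no-three : ∀ u {v} → v ∈ g u → v ∈ g (1 + u) → v ∈ g (2 + u) → ⊥) where

    pins-exist : ∀ t → g (2 + t) ≡ g 0 → ∃[ c ] Pointwise _<_ c (walkBounds 0) × Pins g t c
    pins-exist t closes =
      let y , y∈gt∩gt′   = meet t
          z , z∈gt′∩gt″  = meet (suc t)
          y∈gt , y∈gt′   = x∈p∩q⁻ (g t) (g (suc t)) y∈gt∩gt′
          z∈gt′ , z∈gt″  = x∈p∩q⁻ (g (suc t)) (g (2 + t)) z∈gt′∩gt″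
          a , γ , _ , _ , _ , g≡ = edge (suc t)
          qy , y-term    = ∈-apSet⁻ (subst (y ∈_) g≡ y∈gt′)
          qz , z-term    = ∈-apSet⁻ (subst (z ∈_) g≡ z∈gt′)
          py , py<n , py≡ = vertex-index {n = n} (edge t) y∈gt
          pz , pz<n , pz≡ = vertex-index {n = n} (edge 0) (subst (z ∈_) closes z∈gt″)
          y≢z : y ≢ z
          y≢z y≡z = no-three t y∈gt y∈gt′ (subst (_∈ g (2 + t)) (sym y≡z) z∈gt″)
      in (py ∷ pz ∷ toℕ qy ∷ toℕ qz ∷ []) , (py<n ∷ pz<n ∷ toℕ<n qy ∷ toℕ<n qz ∷ []) ,
         (y , z , py≡ , pz≡ , y≢z , a , γ , g≡ , y-term , z-term)

    walk-exists : ∀ j t → g (2 + (j + t)) ≡ g 0 → ∃[ c ] Pointwise _<_ c (walkBounds j) × Walk g t j c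
    walk-exists zero    t closes = pins-exist t closes
    walk-exists (suc j) t closes =
      let y , y∈gt∩gt′  = meet t
          y∈gt , y∈gt′  = x∈p∩q⁻ (g t) (g (suc t)) y∈gt∩gt′
          p , p<n , p≡  = vertex-index {n = n} (edge t) y∈gt
          e , e<d , e≡  = edge-index {n = n} (edge (suc t)) y∈gt′
          c , c<bounds , w = walk-exists j (suc t) (subst (λ r → g (2 + r) ≡ g 0) (sym (+-suc j t)) closes)
      in (p ∷ e ∷ c) , (p<n ∷ e<d ∷ c<bounds) , (y , p≡ , e≡ , w)

module Cyclic {A : Set} {K : ℕ} .{{_ : NonZero K}} where

  cyc : Vec A K → ℕ → A
  cyc s u = lookup s (u mod K)

  cyc-lookup : (s : Vec A K) (j : Fin K) → cyc s (toℕ j) ≡ lookup s j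
  cyc-lookup s j = cong (lookup s) (toℕ-injective (trans (toℕ-fromℕ< _) (m<n⇒m%n≡m (toℕ<n j))))

  cyc-at : (s : Vec A K) (j : Fin K) {u : ℕ} → toℕ j ≡ u → cyc s u ≡ lookup s j
  cyc-at s j refl = cyc-lookup s j

  cyc-cong : (s : Vec A K) {u v : ℕ} → u % K ≡ v % K → cyc s u ≡ cyc s v
  cyc-cong s eq = cong (lookup s) (toℕ-injective (trans (toℕ-fromℕ< _) (trans eq (sym (toℕ-fromℕ< _)))))

  cyc-periodic : (s : Vec A K) (u : ℕ) → cyc s (u + K) ≡ cyc s u
  cyc-periodic s u = cyc-cong s ([m+n]%n≡m%n u K)

  cyc-reduceˡ : (s : Vec A K) (u t : ℕ) → cyc s (u % K + t) ≡ cyc s (u + t)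
  cyc-reduceˡ s u t = cyc-cong s (begin
    (u % K + t) % K         ≡⟨ %-distribˡ-+ (u % K) t K ⟩
    (u % K % K + t % K) % K ≡⟨ cong (λ r → (r + t % K) % K) (m%n%n≡m%n u K) ⟩
    (u % K + t % K) % K     ≡⟨ sym (%-distribˡ-+ u t K) ⟩
    (u + t) % K             ∎)
    where open ≡-Reasoning

  cyc-reduceʳ : (s : Vec A K) (t u : ℕ) → cyc s (t + u % K) ≡ cyc s (t + u)
  cyc-reduceʳ s t u = trans (cong (cyc s) (+-comm t (u % K)))
    (trans (cyc-reduceˡ s u t) (cong (cyc s) (+-comm u t)))

  cyc-injective-from : ∀ {s s′ : Vec A K} i → i < K →
    (∀ u → u < K → cyc s (u + i) ≡ cyc s′ (u + i)) → s ≡ s′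
  cyc-injective-from {s} {s′} i i<K agreeBelow = Pointwise-≡⇒≡ (ext agreeAt)
    where
    agree : ∀ u → cyc s (u + i) ≡ cyc s′ (u + i)
    agree u = trans (sym (cyc-reduceˡ s u i)) (trans (agreeBelow (u % K) (m%n<n u K)) (cyc-reduceˡ s′ u i))

    shifted : (t : Vec A K) (j : Fin K) → lookup t j ≡ cyc t (toℕ j + K ∸ i + i)
    shifted t j = begin
      lookup t j              ≡⟨ sym (cyc-lookup t j) ⟩
      cyc t (toℕ j)           ≡⟨ sym (cyc-periodic t (toℕ j)) ⟩
      cyc t (toℕ j + K)       ≡⟨ cong (cyc t) (sym (m∸n+n≡m (≤-trans (<⇒≤ i<K) (m≤n+m K (toℕ j))))) ⟩
      cyc t (toℕ j + K ∸ i + i) ∎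
      where open ≡-Reasoning

    agreeAt : ∀ j → lookup s j ≡ lookup s′ j
    agreeAt j = trans (shifted s j) (trans (agree _) (sym (shifted s′ j)))

head≡lookup-zero : ∀ {A : Set} {k} (s : Vec A (suc k)) → head s ≡ lookup s Fin.zero
head≡lookup-zero (_ ∷ _) = refl

last≡lookup-fromℕ : ∀ {A : Set} {k} (s : Vec A (suc k)) → last s ≡ lookup s (fromℕ k)
last≡lookup-fromℕ (_ ∷ [])     = refl
last≡lookup-fromℕ (_ ∷ t ∷ ts) = last≡lookup-fromℕ (t ∷ ts)

lookup-init : ∀ {A : Set} {k} (s : Vec A (suc k)) (j : Fin k) → lookup (init s) j ≡ lookup s (inject₁ j)
lookup-init (_ ∷ _ ∷ _)  Fin.zero    = refl
lookup-init (_ ∷ t ∷ ts) (Fin.suc j) = lookup-init (t ∷ ts) j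

lookup-tail : ∀ {A : Set} {k} (s : Vec A (suc k)) (j : Fin k) → lookup (tail s) j ≡ lookup s (Fin.suc j)
lookup-tail (_ ∷ _) j = refl

∣p∣≡1⇒Nonempty : ∀ {k} {p : Subset k} → ∣ p ∣ ≡ 1 → Nonempty p
∣p∣≡1⇒Nonempty {k} {p} ∣p∣≡1 with nonempty? p
... | yes nonempty = nonempty
... | no empty =
  contradiction (trans (sym ∣p∣≡1) (trans (cong ∣_∣ (Empty-unique empty)) (∣⊥∣≡0 k))) λ ()

module CountedCycleFacts {W n m : ℕ} {x : Fin W} (s : Vec (Subset W) (3 + m)) (counted : CountedCycle W n x s) where

  open Cyclic

  private
    K : ℕ
    K = 3 + m

    chain : IsChain s
    chain = proj₁ (proj₁ (proj₂ counted))

    init-disjoint : IsDisjointChain (init s)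
    init-disjoint = proj₁ (proj₂ (proj₂ (proj₁ (proj₂ counted))))

    tail-disjoint : IsDisjointChain (tail s)
    tail-disjoint = proj₂ (proj₂ (proj₂ (proj₁ (proj₂ counted))))

    toℕ-mod : ∀ {u} → u < K → toℕ (u mod K) ≡ u
    toℕ-mod u<K = trans (toℕ-fromℕ< _) (m<n⇒m%n≡m u<K)

  contained : ContainedIn x s
  contained = proj₂ (proj₂ (proj₂ counted))

  edge-at : ∀ u → IsEdge W n (cyc s u)
  edge-at u = proj₁ counted (u mod K)

  chain-link : ∀ u → 1 + u < K → ∣ cyc s u ∩ cyc s (1 + u) ∣ ≡ 1
  chain-link u 1+u<K = proj₁ chain (u mod K) ((1 + u) mod K)
    (trans (toℕ-mod 1+u<K) (cong suc (sym (toℕ-mod (<-trans (n<1+n u) 1+u<K)))))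

  chain-no-three : ∀ u → 2 + u < K → ∀ {v} → v ∈ cyc s u → v ∈ cyc s (1 + u) → v ∈ cyc s (2 + u) → ⊥
  chain-no-three u 2+u<K {v} v∈₀ v∈₁ v∈₂ =
    proj₂ chain (u mod K) ((1 + u) mod K) ((1 + u) mod K) ((2 + u) mod K) (consecutive u<K 1+u<K)
      (consecutive 1+u<K 2+u<K) u≢1+u (v , x∈p∩q⁺ (x∈p∩q⁺ (v∈₀ , v∈₁) , x∈p∩q⁺ (v∈₁ , v∈₂)))
    where
    1+u<K : 1 + u < K
    1+u<K = <-trans (n<1+n (1 + u)) 2+u<K

    u<K : u < K
    u<K = <-trans (n<1+n u) 1+u<K

    consecutive : ∀ {w} (w<K : w < K) (1+w<K : 1 + w < K) → toℕ ((1 + w) mod K) ≡ suc (toℕ (w mod K))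
    consecutive w<K 1+w<K = trans (toℕ-mod 1+w<K) (cong suc (sym (toℕ-mod w<K)))

    u≢1+u : u mod K ≢ (1 + u) mod K
    u≢1+u eq = 1+n≢n (trans (sym (toℕ-mod 1+u<K)) (trans (cong toℕ (sym eq)) (toℕ-mod u<K)))

  first-disjoint-penultimate : 1 ≤ m → ∀ {v} → v ∈ cyc s 0 → v ∈ cyc s (1 + m) → ⊥
  first-disjoint-penultimate 1≤m {v} v∈first v∈penultimate =
    proj₂ init-disjoint Fin.zero (fromℕ (suc m)) (s≤s (subst (1 ≤_) (sym (toℕ-fromℕ m)) 1≤m))
      (v , x∈p∩q⁺ (subst (v ∈_) first≡ v∈first , subst (v ∈_) penultimate≡ v∈penultimate))
    where
    first≡ : cyc s 0 ≡ lookup (init s) Fin.zero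
    first≡ = trans (cyc-lookup s Fin.zero) (sym (lookup-init s Fin.zero))

    penultimate≡ : cyc s (1 + m) ≡ lookup (init s) (fromℕ (suc m))
    penultimate≡ = trans (cyc-at s _ (trans (toℕ-inject₁ (fromℕ (suc m))) (toℕ-fromℕ (suc m))))
      (sym (lookup-init s (fromℕ (suc m))))

  second-disjoint-last : 1 ≤ m → ∀ {v} → v ∈ cyc s 1 → v ∈ cyc s (2 + m) → ⊥
  second-disjoint-last 1≤m {v} v∈second v∈last =
    proj₂ tail-disjoint Fin.zero (fromℕ (suc m)) (s≤s (subst (1 ≤_) (sym (toℕ-fromℕ m)) 1≤m))
      (v , x∈p∩q⁺ (subst (v ∈_) second≡ v∈second , subst (v ∈_) last≡ v∈last))
    where
    second≡ : cyc s 1 ≡ lookup (tail s) Fin.zero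
    second≡ = trans (cyc-lookup s (Fin.suc Fin.zero)) (sym (lookup-tail s Fin.zero))

    last≡ : cyc s (2 + m) ≡ lookup (tail s) (fromℕ (suc m))
    last≡ = trans (cyc-at s _ (toℕ-fromℕ (2 + m))) (sym (lookup-tail s (fromℕ (suc m))))

  meet-below : ∀ u → u < K → Nonempty (cyc s u ∩ cyc s (1 + u))
  meet-below u (s≤s u≤2+m) with m≤n⇒m<n∨m≡n u≤2+m
  ... | inj₁ u<2+m = ∣p∣≡1⇒Nonempty (chain-link u (s≤s u<2+m))
  ... | inj₂ refl =
    let v , v∈head∩last = ∣p∣≡1⇒Nonempty (proj₁ (proj₂ (proj₂ counted)))
        v∈head , v∈last = x∈p∩q⁻ (head s) (last s) v∈head∩last
    in v , x∈p∩q⁺ (subst (v ∈_) last≡ v∈last , subst (v ∈_) head≡ v∈head)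
    where
    last≡ : last s ≡ cyc s (2 + m)
    last≡ = trans (last≡lookup-fromℕ s) (sym (cyc-at s _ (toℕ-fromℕ (2 + m))))

    head≡ : head s ≡ cyc s (3 + m)
    head≡ = trans (head≡lookup-zero s) (sym (trans (cyc-periodic s 0) (cyc-lookup s Fin.zero)))

  meet : ∀ u → Nonempty (cyc s u ∩ cyc s (suc u))
  meet u = subst₂ (λ p q → Nonempty (p ∩ q)) (cyc-reduceʳ s 0 u) (cyc-reduceʳ s 1 u)
    (meet-below (u % K) (m%n<n u K))

  -- For K = 3 the wrap-around triples are rotations of the chain (s₀, s₁, s₂); for K > 3 the two
  -- outer edges of the triple lie in init s, resp. tail s, at distance K − 2 ≥ 2.
  no-three-below : ∀ u → u < K → ∀ {v} → v ∈ cyc s u → v ∈ cyc s (1 + u) → v ∈ cyc s (2 + u) → ⊥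
  no-three-below u (s≤s u≤2+m) {v} v∈₀ v∈₁ v∈₂ with m≤n⇒m<n∨m≡n u≤2+m
  ... | inj₂ refl with m ≟ 0
  ...   | yes m≡0 = chain-no-three 0 (s≤s (s≤s (s≤s z≤n))) (subst (v ∈_) (cyc-periodic s 0) v∈₁)
                      (subst (v ∈_) (cyc-periodic s 1) v∈₂) (subst (λ k → v ∈ cyc s (2 + k)) m≡0 v∈₀)
  ...   | no m≢0  = second-disjoint-last (n≢0⇒n>0 m≢0) (subst (v ∈_) (cyc-periodic s 1) v∈₂) v∈₀
  no-three-below u (s≤s u≤2+m) {v} v∈₀ v∈₁ v∈₂ | inj₁ (s≤s u≤1+m) with m≤n⇒m<n∨m≡n u≤1+m
  ... | inj₁ u<1+m = chain-no-three u (s≤s (s≤s u<1+m)) v∈₀ v∈₁ v∈₂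
  ... | inj₂ refl with m ≟ 0
  ...   | yes m≡0 = chain-no-three 0 (s≤s (s≤s (s≤s z≤n))) (subst (v ∈_) (cyc-periodic s 0) v∈₂)
                      (subst (λ k → v ∈ cyc s (1 + k)) m≡0 v∈₀) (subst (λ k → v ∈ cyc s (2 + k)) m≡0 v∈₁)
  ...   | no m≢0  = first-disjoint-penultimate (n≢0⇒n>0 m≢0) (subst (v ∈_) (cyc-periodic s 0) v∈₂) v∈₀

  no-three : ∀ u {v} → v ∈ cyc s u → v ∈ cyc s (1 + u) → v ∈ cyc s (2 + u) → ⊥
  no-three u {v} v∈₀ v∈₁ v∈₂ = no-three-below (u % K) (m%n<n u K)
    (reduce 0 v∈₀) (reduce 1 v∈₁) (reduce 2 v∈₂)
    where
    reduce : ∀ t → v ∈ cyc s (t + u) → v ∈ cyc s (t + u % K)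
    reduce t = subst (v ∈_) (sym (cyc-reduceʳ s t u))

module Coding (W n m : ℕ) (x : Fin W) where

  open Walks W n
  open Cyclic

  K : ℕ
  K = 3 + m

  cycleBounds : List ℕ
  cycleBounds = K ∷ d ∷ walkBounds (suc m)

  CycleCode : Vec (Subset W) K → List ℕ → Set
  CycleCode s (i ∷ e ∷ c) =
    i < K × edgesThrough W n x ‼ e ≡ just (cyc s i) × Walk (λ u → cyc s (u + i)) 0 (suc m) c
  CycleCode s _ = ⊥

  cycleCode-injective : ∀ {s s′} c → CycleCode s c → CycleCode s′ c → s ≡ s′
  cycleCode-injective {s} {s′} (i ∷ e ∷ c) (i<K , e≡ , w) (_ , e≡′ , w′) =
    cyc-injective-from i i<K λ u u<K → subst (λ r → cyc s (r + i) ≡ cyc s′ (r + i)) (+-identityʳ u)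
      (walk-determined (suc m) c w w′ first≡ first≡ u (≤-pred u<K))
    where
    first≡ : cyc s i ≡ cyc s′ i
    first≡ = ‼-functional (edgesThrough W n x) e≡ e≡′

  cycleCode-exists : ∀ {s} → CountedCycle W n x s → ∃[ c ] Pointwise _<_ c cycleBounds × CycleCode s c
  cycleCode-exists {s} counted =
    let e , e<d , e≡ = edge-index {n = n} (edge-at i) (subst (x ∈_) (sym (cyc-lookup s j)) x∈)
        c , c<bounds , w = walk-exists g (λ u → edge-at (u + i)) (λ u → meet (u + i))
                             (λ u → no-three (u + i)) (suc m) 0 closes
    in (i ∷ e ∷ c) , (toℕ<n j ∷ e<d ∷ c<bounds) , (toℕ<n j , e≡ , w)
    where
    open CountedCycleFacts {n = n} s counted

    j : Fin K
    j = proj₁ contained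

    x∈ : x ∈ lookup s j
    x∈ = proj₂ contained

    i : ℕ
    i = toℕ j

    g : ℕ → Subset W
    g u = cyc s (u + i)

    closes : g (2 + (suc m + 0)) ≡ g 0
    closes = begin
      cyc s (3 + (m + 0) + i) ≡⟨ cong (λ r → cyc s (3 + r + i)) (+-identityʳ m) ⟩
      cyc s (K + i)           ≡⟨ cong (cyc s) (+-comm K i) ⟩
      cyc s (i + K)           ≡⟨ cyc-periodic s i ⟩
      cyc s i                 ∎
      where open ≡-Reasoning

proposition14 : (W n : ℕ) → 1 ≤ W → 1 ≤ n → (k : ℕ) → 3 ≤ k → (x : Fin W) →
    (cs : List (Vec (Subset W) k)) → Unique cs → All (CountedCycle W n x) cs →
    length cs ≤ k ^ 2 * maxDegree W n * (n * maxDegree W n) ^ (k ∸ 2) * n ^ 4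
proposition14 W n _ _ _ (s≤s (s≤s (s≤s {n = m} _))) x cs unique counted = begin
  length cs                                 ≤⟨ length-≤-by-coding CycleCode (box cycleBounds) unique encode
                                                  cycleCode-injective ⟩
  length (box cycleBounds)                  ≡⟨ length-box cycleBounds ⟩
  K * (d * product (walkBounds (suc m)))    ≡⟨ cong (λ r → K * (d * r)) (product-walkBounds (suc m)) ⟩
  K * (d * ((n * d) ^ suc m * n ^ 4))       ≤⟨ *-monoˡ-≤ (d * ((n * d) ^ suc m * n ^ 4)) (m≤m*n K (K * 1)) ⟩
  K ^ 2 * (d * ((n * d) ^ suc m * n ^ 4))   ≡⟨ sym (*-assoc (K ^ 2) d _) ⟩
  K ^ 2 * d * ((n * d) ^ suc m * n ^ 4)     ≡⟨ sym (*-assoc (K ^ 2 * d) _ (n ^ 4)) ⟩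
  K ^ 2 * d * (n * d) ^ suc m * n ^ 4       ∎
  where
  open Walks W n
  open Coding W n m x
  open ≤-Reasoning

  encode : ∀ {s} → s ∈ₗ cs → ∃[ c ] c ∈ₗ box cycleBounds × CycleCode s c
  encode {s} s∈cs =
    let c , c<bounds , code = cycleCode-exists {s} (All.lookup counted s∈cs) in c , ∈-box c<bounds , code
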